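{- Suppose that every finite simple graph $G$ satisfies $\eta(G) \ge \chi(G)$ (Hadwiger's conjecture). Then for every positive integer $t$, every finite simple graph $G$ of order $n = 4t-1$ with independence number $\alpha(G) = 2$ satisfies $\operatorname{cm}(G) \ge t$.
   Context: All graphs are finite and simple. $\chi(G)$ is the chromatic number and $\alpha(G)$ the independence number of $G$. $\eta(G)$ (the Hadwiger number) is the largest $t$ such that $G$ has a $K_t$ minor. Two vertex-disjoint subgraphs $H, H'$ of $G$ are called connected if there are vertices $u \in H$, $v \in H'$ with $uv \in E(G)$; a collection of pairwise vertex-disjoint subgraphs is connected if every two of its members are connected. A connected matching is a collection of pairwise vertex-disjoint edges (each regarded as the subgraph consisting of the edge and its two endpoints) which is connected in this sense. $\operatorname{cm}(G)$ denotes the maximum size of a connected matching in $G$. -}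

module Defs where

open import Data.Nat using (ℕ; suc; _≤_)
open import Data.Fin using (Fin)
open import Data.Bool using (Bool; true; false)
open import Data.Maybe using (Maybe; just)
open import Data.Product using (_×_; _,_; ∃; ∃-syntax; Σ-syntax; proj₁; proj₂)
open import Relation.Binary.PropositionalEquality using (_≡_; _≢_)
open import Function.Definitions using (Injective)

record Graph (n : ℕ) : Set where
  field
    adj   : Fin n → Fin n → Bool
    sym   : ∀ u v → adj u v ≡ adj v u
    irrefl : ∀ u → adj u u ≡ false
open Graph public

Adj : ∀ {n} → Graph n → Fin n → Fin n → Set
Adj G u v = adj G u v ≡ true

Colourable : ∀ {n} → Graph n → ℕ → Set
Colourable {n} G k = Σ[ c ∈ (Fin n → Fin k) ] (∀ (u v : Fin n) → Adj G u v → c u ≢ c v)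

IsChromaticNumber : ∀ {n} → Graph n → ℕ → Set
IsChromaticNumber G k = Colourable G k × (∀ j → Colourable G j → k ≤ j)

HasIndependentSet : ∀ {n} → Graph n → ℕ → Set
HasIndependentSet {n} G k =
  Σ[ s ∈ (Fin k → Fin n) ] (Injective _≡_ _≡_ s × (∀ (i j : Fin k) → adj G (s i) (s j) ≡ false))

IsIndependenceNumber : ∀ {n} → Graph n → ℕ → Set
IsIndependenceNumber G a = HasIndependentSet G a × (∀ j → HasIndependentSet G j → j ≤ a)

data WalkIn {n} (G : Graph n) (P : Fin n → Set) : Fin n → Fin n → Set where
  here : ∀ {u} → P u → WalkIn G P u u
  step : ∀ {u w v} → P u → Adj G u w → WalkIn G P w v → WalkIn G P u v

-- K_t minor given by branch sets: f u = just i means u lies in branch set i,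
-- f u = nothing means u is deleted.
HasCompleteMinor : ∀ {n} → Graph n → ℕ → Set
HasCompleteMinor {n} G t =
  Σ[ f ∈ (Fin n → Maybe (Fin t)) ] ( (∀ (i : Fin t) → ∃[ u ] (f u ≡ just i))
         × (∀ (i : Fin t) (u v : Fin n) → f u ≡ just i → f v ≡ just i →
              WalkIn G (λ w → f w ≡ just i) u v)
         × (∀ (i j : Fin t) → i ≢ j →
              ∃[ u ] ∃[ v ] (f u ≡ just i × f v ≡ just j × Adj G u v)))

IsHadwigerNumber : ∀ {n} → Graph n → ℕ → Set
IsHadwigerNumber G m = HasCompleteMinor G m × (∀ j → HasCompleteMinor G j → j ≤ m)

-- a connected matching of size t: endpoints e (i , false), e (i , true) of
-- the i-th edge; all 2t endpoints distinct; each pair is an edge; any two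
-- distinct edges are joined by an edge of G.
HasConnectedMatching : ∀ {n} → Graph n → ℕ → Set
HasConnectedMatching {n} G t =
  Σ[ e ∈ (Fin t × Bool → Fin n) ] ( Injective _≡_ _≡_ e
         × (∀ (i : Fin t) → Adj G (e (i , false)) (e (i , true)))
         × (∀ (i j : Fin t) → i ≢ j →
              ∃[ b ] ∃[ b' ] Adj G (e (i , b)) (e (j , b'))))

HadwigerConjecture : Set
HadwigerConjecture =
  ∀ (n : ℕ) (G : Graph n) (k m : ℕ) →
    IsChromaticNumber G k → IsHadwigerNumber G m → k ≤ m

-- With α(G) = 2 every colour class has at most two vertices, so χ(G) ≥ n/2, which for
-- n = 4t - 1 means χ(G) ≥ 2t; Hadwiger's conjecture then gives a K_m minor with m ≥ 2t.
-- As n < 2m, fewer branch sets have at least three vertices than have exactly one.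
-- Each two-vertex branch set, each large branch set next to a singleton, and each two
-- remaining singletons yield an edge covering a whole branch set, and any two such edges
-- are joined because their branch sets are adjacent; counting gives t of them.
-- χ(G) and η(G) exist only classically, but having a connected matching of size t is
-- decidable, so it suffices to refute its absence.
module Submission where

open import Defs hiding (sym)
open import Data.Bool using (Bool; true; false)
import Data.Bool.Properties as BoolP
open import Data.Empty using (⊥-elim)
open import Data.Fin as Fin using (Fin; zero; suc)
import Data.Fin.Properties as FinP
open import Data.List using (List; []; _∷_; _++_; length; lookup; allFin)
open import Data.List.Properties using (length-tabulate)
open import Data.List.Membership.Propositional using (_∈_; _∉_)
open import Data.List.Membership.Propositional.Properties using (∈-++⁻; ∈-lookup)
open import Data.List.Relation.Binary.Subset.Propositional using (_⊆_)
open import Data.List.Relation.Unary.All as All using (All; []; _∷_)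
open import Data.List.Relation.Unary.All.Properties using (¬Any⇒All¬; All¬⇒¬Any)
open import Data.List.Relation.Unary.AllPairs using ([]; _∷_)
open import Data.List.Relation.Unary.Any using (here; there)
open import Data.List.Relation.Unary.Unique.Propositional using (Unique)
open import Data.List.Relation.Unary.Unique.Propositional.Properties
  using (allFin⁺; ++⁺; Unique[x∷xs]⇒x∉xs)
open import Data.Maybe using (Maybe; just; nothing)
import Data.Maybe.Properties as MaybeP
open import Data.Nat using (ℕ; zero; suc; _+_; _*_; _∸_; _≤_; _<_; z≤n; s≤s; s≤s⁻¹)
import Data.Nat.Properties as ℕP
open import Data.Nat.Tactic.RingSolver using (solve-∀)
open import Data.Product using (_×_; _,_; ∃; ∃-syntax; proj₁; proj₂)
import Data.Product.Properties as ×P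
open import Data.Sum using (_⊎_; inj₁; inj₂; [_,_]; [_,_]′; map₁; map₂)
import Data.Sum.Properties as ⊎P
open import Function using (_∘_; flip; id)
open import Function.Definitions using (Injective)
open import Relation.Binary using (tri<; tri≈; tri>)
open import Relation.Binary.PropositionalEquality
  using (_≡_; _≢_; refl; sym; trans; cong; subst; subst₂; _≗_)
open import Relation.Nullary using (¬_; Dec; yes; no)
open import Relation.Nullary.Decidable using (_×-dec_; _⊎-dec_; ¬?; _→-dec_; map′; decidable-stable)

adj⇒≢ : ∀ {n} (G : Graph n) {u v : Fin n} → Adj G u v → u ≢ v
adj⇒≢ G {u} uv refl with trans (sym uv) (irrefl G u)
... | ()

WalkIn-source : ∀ {n} {G : Graph n} {P : Fin n → Set} {u v} → WalkIn G P u v → P u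
WalkIn-source (here p)     = p
WalkIn-source (step p _ _) = p

WalkIn-leave : ∀ {n} {G : Graph n} {P : Fin n → Set} {u v} →
  u ≢ v → WalkIn G P u v → ∃[ w ] (P w × Adj G u w)
WalkIn-leave u≢u (here _)      = ⊥-elim (u≢u refl)
WalkIn-leave _   (step _ uw w⇝v) = _ , WalkIn-source w⇝v , uw

Unique⇒lookup-injective : ∀ {A : Set} {xs : List A} → Unique xs →
  ∀ i j → lookup xs i ≡ lookup xs j → i ≡ j
Unique⇒lookup-injective (_ ∷ _)        zero    zero    _  = refl
Unique⇒lookup-injective (x∉xs ∷ _)     zero    (suc j) eq = ⊥-elim (All.lookup x∉xs (∈-lookup j) eq)
Unique⇒lookup-injective (x∉xs ∷ _)     (suc i) zero    eq = ⊥-elim (All.lookup x∉xs (∈-lookup i) (sym eq))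
Unique⇒lookup-injective (_ ∷ unique)   (suc i) (suc j) eq = cong suc (Unique⇒lookup-injective unique i j eq)

Unique⇒length≤ : ∀ {n} {xs : List (Fin n)} → Unique xs → length xs ≤ n
Unique⇒length≤ unique = FinP.injective⇒≤ (Unique⇒lookup-injective unique _ _)

∉-All : ∀ {A : Set} {Q : A → Set} {x xs} → ¬ Q x → All Q xs → x ∉ xs
∉-All ¬Qx all x∈xs = ¬Qx (All.lookup all x∈xs)

double-suc : ∀ a → suc a + suc a ≡ 2 + (a + a)
double-suc a = cong suc (ℕP.+-suc a a)

halve-≤ : ∀ {r x} → suc r + suc r ≤ 2 + x → r + r ≤ x
halve-≤ {r} {x} le = s≤s⁻¹ (s≤s⁻¹ (subst (_≤ 2 + x) (double-suc r) le))

a+[1+a]≤k+k⇒a<k : ∀ a k → a + suc a ≤ k + k → a < k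
a+[1+a]≤k+k⇒a<k a k le = ℕP.≮⇒≥ λ k<1+a →
  let k≤a = s≤s⁻¹ k<1+a in
  ℕP.<⇒≱ (ℕP.<-≤-trans (ℕP.+-monoʳ-< a (ℕP.n<1+n a)) le) (ℕP.+-mono-≤ k≤a k≤a)

a<k⇒a+[1+a]<k+k : ∀ {a k} → a < k → a + suc a < k + k
a<k⇒a+[1+a]<k+k {a} a<k = ℕP.<-≤-trans (ℕP.+-monoˡ-< (suc a) (ℕP.n<1+n a)) (ℕP.+-mono-≤ a<k a<k)

4[1+t]∸1≡a+[1+a] : ∀ t → 4 * suc t ∸ 1 ≡ (t + suc t) + suc (t + suc t)
4[1+t]∸1≡a+[1+a] t = normalised t
  where
  normalised : ∀ t → t + (suc t + (suc t + (suc t + 0))) ≡ (t + suc t) + suc (t + suc t)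
  normalised = solve-∀

¬¬-least : ∀ (P : ℕ → Set) {N} → P N → ¬ ¬ (∃[ k ] (P k × ∀ j → P j → k ≤ j))
¬¬-least P {N} PN noLeast = below (suc N) N (ℕP.n<1+n N) PN
  where
  below : ∀ j i → i < j → ¬ P i
  below (suc j) i (s≤s i≤j) Pi =
    noLeast (i , Pi , λ i' Pi' → ℕP.≮⇒≥ λ i'<i → below j i' (ℕP.<-≤-trans i'<i i≤j) Pi')

¬¬-greatest : ∀ (P : ℕ → Set) {B} → P 0 → (∀ j → P j → j ≤ B) →
  ¬ ¬ (∃[ k ] (P k × ∀ j → P j → j ≤ k))
¬¬-greatest P {B} P0 bounded noGreatest = above (suc B) 0 (ℕP.m≤m+n (suc B) 0) P0
  where
  above : ∀ d j → B < d + j → ¬ P j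
  above zero    j B<j     Pj = ℕP.<⇒≱ B<j (bounded j Pj)
  above (suc d) j B<1+d+j Pj = noGreatest (j , Pj , λ i Pi → ℕP.≮⇒≥ λ j<i →
    above d i (ℕP.<-≤-trans B<1+d+j (subst (_≤ d + i) (ℕP.+-suc d j) (ℕP.+-monoʳ-≤ d j<i))) Pi)

module ColourClasses {n k} (G : Graph n) (c : Fin n → Fin k)
  (proper : ∀ (u v : Fin n) → Adj G u v → c u ≢ c v) where

  sameColour⇒nonadjacent : ∀ {u v} → c u ≡ c v → adj G u v ≡ false
  sameColour⇒nonadjacent {u} {v} same with adj G u v in uv
  ... | true  = ⊥-elim (proper u v uv same)
  ... | false = refl

  monochromatic-triple : ∀ {a b d} → a Fin.< b → b Fin.< d → c a ≡ c b → c b ≡ c d →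
    HasIndependentSet G 3
  monochromatic-triple {a} {b} {d} a<b b<d ab bd =
    s , s-injective _ _ , λ i j → sameColour⇒nonadjacent (trans (colour i) (sym (colour j)))
    where
    s : Fin 3 → Fin n
    s zero             = a
    s (suc zero)       = b
    s (suc (suc zero)) = d
    colour : ∀ i → c (s i) ≡ c a
    colour zero             = refl
    colour (suc zero)       = sym ab
    colour (suc (suc zero)) = sym (trans ab bd)
    a<d : a Fin.< d
    a<d = FinP.<-trans a<b b<d
    s-injective : ∀ i j → s i ≡ s j → i ≡ j
    s-injective zero             zero             _  = refl
    s-injective zero             (suc zero)       eq = ⊥-elim (FinP.<⇒≢ a<b eq)
    s-injective zero             (suc (suc zero)) eq = ⊥-elim (FinP.<⇒≢ a<d eq)
    s-injective (suc zero)       zero             eq = ⊥-elim (FinP.<⇒≢ a<b (sym eq))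
    s-injective (suc zero)       (suc zero)       _  = refl
    s-injective (suc zero)       (suc (suc zero)) eq = ⊥-elim (FinP.<⇒≢ b<d eq)
    s-injective (suc (suc zero)) zero             eq = ⊥-elim (FinP.<⇒≢ a<d (sym eq))
    s-injective (suc (suc zero)) (suc zero)       eq = ⊥-elim (FinP.<⇒≢ b<d (sym eq))
    s-injective (suc (suc zero)) (suc (suc zero)) _  = refl

  HasEarlierTwin : Fin n → Set
  HasEarlierTwin u = ∃[ w ] (w Fin.< u × c w ≡ c u)

  hasEarlierTwin? : ∀ u → Dec (HasEarlierTwin u)
  hasEarlierTwin? u = FinP.any? λ w → (w FinP.<? u) ×-dec (c w Fin.≟ c u)

  code : ∀ u → Dec (HasEarlierTwin u) → Fin k ⊎ Fin k
  code u (no _)  = inj₁ (c u)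
  code u (yes _) = inj₂ (c u)

  -- With no independent 3-set every colour class has at most two vertices, so a
  -- vertex is determined by its colour and by whether it is the later of its class.
  code-injective : ¬ HasIndependentSet G 3 →
    ∀ u v (du : Dec (HasEarlierTwin u)) (dv : Dec (HasEarlierTwin v)) → code u du ≡ code v dv → u ≡ v
  code-injective _ u v (no ¬tu) (no ¬tv) eq with FinP.<-cmp u v | ⊎P.inj₁-injective eq
  ... | tri< u<v _ _ | same = ⊥-elim (¬tv (u , u<v , same))
  ... | tri≈ _ u≡v _ | _    = u≡v
  ... | tri> _ _ v<u | same = ⊥-elim (¬tu (v , v<u , sym same))
  code-injective noTriple u v (yes (w , w<u , wu)) (yes (w' , w'<v , w'v)) eq
    with FinP.<-cmp u v | ⊎P.inj₂-injective eq
  ... | tri< u<v _ _ | same = ⊥-elim (noTriple (monochromatic-triple w<u u<v wu same))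
  ... | tri≈ _ u≡v _ | _    = u≡v
  ... | tri> _ _ v<u | same = ⊥-elim (noTriple (monochromatic-triple w'<v v<u w'v (sym same)))
  code-injective _ u v (yes _) (no _) ()
  code-injective _ u v (no _) (yes _) ()

join-injective : ∀ a b {x y : Fin a ⊎ Fin b} → Fin.join a b x ≡ Fin.join a b y → x ≡ y
join-injective a b {x} {y} eq =
  trans (sym (FinP.splitAt-join a b x)) (trans (cong (Fin.splitAt a) eq) (FinP.splitAt-join a b y))

Colourable⇒n≤k+k : ∀ {n} (G : Graph n) {k} → Colourable G k → ¬ HasIndependentSet G 3 → n ≤ k + k
Colourable⇒n≤k+k G {k} (c , proper) noTriple = FinP.injective⇒≤ {f = encode} λ {u} {v} eq →
  code-injective noTriple u v (hasEarlierTwin? u) (hasEarlierTwin? v) (join-injective k k eq)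
  where
  open ColourClasses G c proper
  encode : Fin _ → Fin (k + k)
  encode u = Fin.join k k (code u (hasEarlierTwin? u))

Colourable-self : ∀ {n} (G : Graph n) → Colourable G n
Colourable-self G = (λ u → u) , λ u v → adj⇒≢ G

HasCompleteMinor-zero : ∀ {n} (G : Graph n) → HasCompleteMinor G 0
HasCompleteMinor-zero G = (λ _ → nothing) , (λ ()) , (λ ()) , λ ()

HasCompleteMinor⇒≤ : ∀ {n} (G : Graph n) j → HasCompleteMinor G j → j ≤ n
HasCompleteMinor⇒≤ G j (f , nonempty , _) = FinP.injective⇒≤ {f = proj₁ ∘ nonempty} λ {i} {i'} eq →
  MaybeP.just-injective (trans (sym (proj₂ (nonempty i))) (trans (cong f eq) (proj₂ (nonempty i'))))

consPair : ∀ {n k} → Fin n → Fin n → (Fin k × Bool → Fin n) → Fin (suc k) × Bool → Fin n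
consPair a b e (zero , false) = a
consPair a b e (zero , true)  = b
consPair a b e (suc i , x)    = e (i , x)

consPair-cong : ∀ {n k} (a b : Fin n) {e e' : Fin k × Bool → Fin n} →
  e ≗ e' → consPair a b e ≗ consPair a b e'
consPair-cong a b e≗e' (zero , false) = refl
consPair-cong a b e≗e' (zero , true)  = refl
consPair-cong a b e≗e' (suc i , x)    = e≗e' (i , x)

consPair-η : ∀ {n k} (e : Fin (suc k) × Bool → Fin n) →
  e ≗ consPair (e (zero , false)) (e (zero , true)) (λ (i , x) → e (suc i , x))
consPair-η e (zero , false) = refl
consPair-η e (zero , true)  = refl
consPair-η e (suc i , x)    = refl

anyFunction? : ∀ {n} k {P : (Fin k × Bool → Fin n) → Set} → (∀ e → Dec (P e)) →
  (∀ {e e'} → e ≗ e' → P e → P e') → Dec (∃ P)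
anyFunction? zero {P} P? resp = map′ (λ p → _ , p) (λ (e , pe) → resp (λ { (() , _) }) pe) (P? λ { (() , _) })
anyFunction? (suc k) {P} P? resp = map′
  (λ (a , b , e , pe) → _ , pe)
  (λ (e , pe) → e (zero , false) , e (zero , true) , _ , resp (consPair-η e) pe)
  (FinP.any? λ a → FinP.any? λ b →
    anyFunction? k (λ e → P? (consPair a b e)) (λ e≗e' → resp (consPair-cong a b e≗e')))

all-Fin×Bool? : ∀ {t} {Q : Fin t × Bool → Set} → (∀ x → Dec (Q x)) → Dec (∀ x → Q x)
all-Fin×Bool? Q? = map′
  (λ q → λ { (i , false) → proj₁ (q i) ; (i , true) → proj₂ (q i) })
  (λ q i → q (i , false) , q (i , true))
  (FinP.all? λ i → Q? (i , false) ×-dec Q? (i , true))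

any-Bool? : {Q : Bool → Set} → (∀ b → Dec (Q b)) → Dec (∃ Q)
any-Bool? Q? = map′
  [ (λ q → false , q) , (λ q → true , q) ]
  (λ { (false , q) → inj₁ q ; (true , q) → inj₂ q })
  (Q? false ⊎-dec Q? true)

module _ {n} (G : Graph n) (t : ℕ) where

  IsConnectedMatching : (Fin t × Bool → Fin n) → Set
  IsConnectedMatching e = Injective _≡_ _≡_ e
    × (∀ (i : Fin t) → Adj G (e (i , false)) (e (i , true)))
    × (∀ (i j : Fin t) → i ≢ j → ∃[ b ] ∃[ b' ] Adj G (e (i , b)) (e (j , b')))

  IsConnectedMatching-resp : ∀ {e e'} → e ≗ e' → IsConnectedMatching e → IsConnectedMatching e'
  IsConnectedMatching-resp e≗e' (injective , edges , linked) =
    (λ eq → injective (trans (e≗e' _) (trans eq (sym (e≗e' _))))) ,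
    (λ i → subst₂ (Adj G) (e≗e' _) (e≗e' _) (edges i)) ,
    λ i j i≢j → let (b , b' , bb') = linked i j i≢j in b , b' , subst₂ (Adj G) (e≗e' _) (e≗e' _) bb'

  isConnectedMatching? : ∀ e → Dec (IsConnectedMatching e)
  isConnectedMatching? e =
    map′ (λ inj {x} {y} → inj x y) (λ inj x y → inj)
      (all-Fin×Bool? λ x → all-Fin×Bool? λ y → (e x Fin.≟ e y) →-dec ×P.≡-dec Fin._≟_ BoolP._≟_ x y)
    ×-dec FinP.all? (λ i → adj? _ _)
    ×-dec FinP.all? (λ i → FinP.all? λ j → ¬? (i Fin.≟ j) →-dec
            any-Bool? λ b → any-Bool? λ b' → adj? (e (i , b)) (e (j , b')))
    where
    adj? : ∀ u v → Dec (Adj G u v)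
    adj? u v = adj G u v BoolP.≟ true

  hasConnectedMatching? : Dec (HasConnectedMatching G t)
  hasConnectedMatching? = anyFunction? t isConnectedMatching? IsConnectedMatching-resp

module BranchSets {n m : ℕ} (G : Graph n) (f : Fin n → Maybe (Fin m))
  (nonempty : ∀ (i : Fin m) → ∃[ u ] (f u ≡ just i))
  (connected : ∀ (i : Fin m) (u v : Fin n) → f u ≡ just i → f v ≡ just i →
                 WalkIn G (λ w → f w ≡ just i) u v)
  (joined : ∀ (i j : Fin m) → i ≢ j → ∃[ u ] ∃[ v ] (f u ≡ just i × f v ≡ just j × Adj G u v)) where

  infix 4 _∈ᵇ_
  _∈ᵇ_ : Fin n → Fin m → Set
  u ∈ᵇ i = f u ≡ just i

  _∈ᵇ?_ : ∀ u i → Dec (u ∈ᵇ i)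
  u ∈ᵇ? i = MaybeP.≡-dec Fin._≟_ (f u) (just i)

  ∈ᵇ-unique : ∀ {u i j} → u ∈ᵇ i → u ∈ᵇ j → i ≡ j
  ∈ᵇ-unique u∈i u∈j = MaybeP.just-injective (trans (sym u∈i) u∈j)

  Single : Fin m → Set
  Single i = ∃[ s ] (s ∈ᵇ i × ∀ w → w ∈ᵇ i → w ≡ s)

  Pair : Fin m → Set
  Pair i = ∃[ u ] ∃[ v ] (u ∈ᵇ i × v ∈ᵇ i × Adj G u v × ∀ w → w ∈ᵇ i → w ≡ u ⊎ w ≡ v)

  Large : Fin m → Set
  Large i = ∃[ u ] ∃[ v ] ∃[ x ] (u ∈ᵇ i × v ∈ᵇ i × x ∈ᵇ i × u ≢ v × u ≢ x × v ≢ x)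

  data Shape (i : Fin m) : Set where
    single : Single i → Shape i
    pair   : Pair i → Shape i
    large  : Large i → Shape i

  -- A branch set with a second vertex w is connected, so a walk from its root r
  -- to w leaves r along an edge rr' inside it; either a third vertex exists or
  -- the branch set is exactly that edge.
  shape : ∀ i → Shape i
  shape i with nonempty i
  ... | r , r∈ with FinP.any? (λ w → (w ∈ᵇ? i) ×-dec ¬? (w Fin.≟ r))
  ... | no noOther = single (r , r∈ , onlyRoot)
    where
    onlyRoot : ∀ w → w ∈ᵇ i → w ≡ r
    onlyRoot w w∈ with w Fin.≟ r
    ... | yes w≡r = w≡r
    ... | no  w≢r = ⊥-elim (noOther (w , w∈ , w≢r))
  ... | yes (w , w∈ , w≢r) with WalkIn-leave (w≢r ∘ sym) (connected i r w r∈ w∈)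
  ... | r' , r'∈ , rr' with FinP.any? (λ x → (x ∈ᵇ? i) ×-dec ¬? (x Fin.≟ r) ×-dec ¬? (x Fin.≟ r'))
  ... | yes (x , x∈ , x≢r , x≢r') =
    large (r , r' , x , r∈ , r'∈ , x∈ , adj⇒≢ G rr' , x≢r ∘ sym , x≢r' ∘ sym)
  ... | no noThird = pair (r , r' , r∈ , r'∈ , rr' , endpoint)
    where
    endpoint : ∀ x → x ∈ᵇ i → x ≡ r ⊎ x ≡ r'
    endpoint x x∈ with x Fin.≟ r | x Fin.≟ r'
    ... | yes x≡r | _        = inj₁ x≡r
    ... | no  _   | yes x≡r' = inj₂ x≡r'
    ... | no x≢r  | no x≢r'  = ⊥-elim (noThird (x , x∈ , x≢r , x≢r'))

  Single⇒¬Pair : ∀ {i} → Single i → ¬ Pair i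
  Single⇒¬Pair (_ , _ , only) (u , v , u∈ , v∈ , uv , _) =
    adj⇒≢ G uv (trans (only u u∈) (sym (only v v∈)))

  Single⇒¬Large : ∀ {i} → Single i → ¬ Large i
  Single⇒¬Large (_ , _ , only) (u , v , _ , u∈ , v∈ , _ , u≢v , _) =
    u≢v (trans (only u u∈) (sym (only v v∈)))

  Pair⇒¬Large : ∀ {i} → Pair i → ¬ Large i
  Pair⇒¬Large (_ , _ , _ , _ , _ , cover) (u , v , x , u∈ , v∈ , x∈ , u≢v , u≢x , v≢x)
    with cover u u∈ | cover v v∈ | cover x x∈
  ... | inj₁ a | inj₁ b | _      = u≢v (trans a (sym b))
  ... | inj₂ a | inj₂ b | _      = u≢v (trans a (sym b))
  ... | inj₁ a | _      | inj₁ c = u≢x (trans a (sym c))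
  ... | inj₂ a | _      | inj₂ c = u≢x (trans a (sym c))
  ... | _      | inj₁ b | inj₁ c = v≢x (trans b (sym c))
  ... | _      | inj₂ b | inj₂ c = v≢x (trans b (sym c))

  vertices : ∀ {i} → Shape i → List (Fin n)
  vertices (single (s , _))        = s ∷ []
  vertices (pair (u , v , _))      = u ∷ v ∷ []
  vertices (large (u , v , x , _)) = u ∷ v ∷ x ∷ []

  vertices-∈ᵇ : ∀ {i} (s : Shape i) {v} → v ∈ vertices s → v ∈ᵇ i
  vertices-∈ᵇ (single (_ , s∈ , _))                  (here refl)                 = s∈
  vertices-∈ᵇ (pair (_ , _ , u∈ , _))                (here refl)                 = u∈
  vertices-∈ᵇ (pair (_ , _ , _ , v∈ , _))            (there (here refl))         = v∈
  vertices-∈ᵇ (large (_ , _ , _ , u∈ , _))           (here refl)                 = u∈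
  vertices-∈ᵇ (large (_ , _ , _ , _ , v∈ , _))       (there (here refl))         = v∈
  vertices-∈ᵇ (large (_ , _ , _ , _ , _ , x∈ , _))   (there (there (here refl))) = x∈

  vertices-unique : ∀ {i} (s : Shape i) → Unique (vertices s)
  vertices-unique (single _) = [] ∷ []
  vertices-unique (pair (_ , _ , _ , _ , uv , _)) = (adj⇒≢ G uv ∷ []) ∷ [] ∷ []
  vertices-unique (large (_ , _ , _ , _ , _ , _ , u≢v , u≢x , v≢x)) =
    (u≢v ∷ u≢x ∷ []) ∷ (v≢x ∷ []) ∷ [] ∷ []

  support : List (Fin m) → List (Fin n)
  support []       = []
  support (i ∷ is) = vertices (shape i) ++ support is

  ∈-support : ∀ is {v} → v ∈ support is → ∃[ i ] (i ∈ is × v ∈ᵇ i)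
  ∈-support (i ∷ is) v∈ with ∈-++⁻ (vertices (shape i)) v∈
  ... | inj₁ v∈i = i , here refl , vertices-∈ᵇ (shape i) v∈i
  ... | inj₂ v∈is = let (j , j∈is , v∈j) = ∈-support is v∈is in j , there j∈is , v∈j

  support-unique : ∀ {is} → Unique is → Unique (support is)
  support-unique {[]}     _              = []
  support-unique {i ∷ is} (i∉is ∷ unique) =
    ++⁺ (vertices-unique (shape i)) (support-unique unique) λ (v∈i , v∈is) →
      let (j , j∈is , v∈j) = ∈-support is v∈is in
      All.lookup i∉is j∈is (∈ᵇ-unique (vertices-∈ᵇ (shape i) v∈i) v∈j)

  record Classes : Set where
    constructor classes
    field
      pairs larges singles : List (Fin m)
      allPair   : All Pair pairs
      allLarge  : All Large larges
      allSingle : All Single singles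
  open Classes

  insert : ∀ i → Shape i → Classes → Classes
  insert i (single s) (classes ps ls ss aP aL aS) = classes ps ls (i ∷ ss) aP aL (s ∷ aS)
  insert i (pair p)   (classes ps ls ss aP aL aS) = classes (i ∷ ps) ls ss (p ∷ aP) aL aS
  insert i (large l)  (classes ps ls ss aP aL aS) = classes ps (i ∷ ls) ss aP (l ∷ aL) aS

  classify : List (Fin m) → Classes
  classify []       = classes [] [] [] [] [] []
  classify (i ∷ is) = insert i (shape i) (classify is)

  count : Classes → ℕ
  count C = length (pairs C) + (length (larges C) + length (singles C))

  count-insert : ∀ i (s : Shape i) C → count (insert i s C) ≡ suc (count C)
  count-insert i (single _) (classes ps _ _ _ _ _) = trans (cong (length ps +_) (ℕP.+-suc _ _)) (ℕP.+-suc _ _)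
  count-insert i (pair _)   _                      = refl
  count-insert i (large _)  _                      = ℕP.+-suc _ _

  classify-length : ∀ is → length is ≡ count (classify is)
  classify-length []       = refl
  classify-length (i ∷ is) = trans (cong suc (classify-length is)) (sym (count-insert i (shape i) (classify is)))

  -- Every branch set adds 2 to the right-hand side but 1, 2 or 3 vertices to the support;
  -- the singles and larges terms balance the difference.
  support-weight : ∀ is → let C = classify is in
    length (support is) + length (singles C) ≡ (length is + length is) + length (larges C)
  support-weight []       = refl
  support-weight (i ∷ is) = insert-weight (shape i) (classify is) (support-weight is)
    where
    k : ℕ
    k = length is
    insert-weight : ∀ (s : Shape i) C →
      length (support is) + length (singles C) ≡ (k + k) + length (larges C) →
      let C' = insert i s C in
      length (vertices s ++ support is) + length (singles C') ≡ (suc k + suc k) + length (larges C')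
    insert-weight (single _) (classes _ ls _ _ _ _) eq =
      trans (cong suc (ℕP.+-suc _ _)) (trans (cong (2 +_) eq) (sym (cong (_+ length ls) (double-suc k))))
    insert-weight (pair _)   (classes _ ls _ _ _ _) eq =
      trans (cong (2 +_) eq) (sym (cong (_+ length ls) (double-suc k)))
    insert-weight (large _)  (classes _ ls _ _ _ _) eq =
      trans (cong (3 +_) eq)
        (sym (trans (cong (_+ suc (length ls)) (double-suc k)) (cong (2 +_) (ℕP.+-suc (k + k) (length ls)))))

  DistinctWithin : List (Fin m) → List (Fin m) → Set
  DistinctWithin is js = Unique js × js ⊆ is

  DistinctWithin-cons : ∀ {i is js} → i ∉ is →
    DistinctWithin is js → DistinctWithin (i ∷ is) (i ∷ js)
  DistinctWithin-cons i∉is (unique , js⊆is) =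
    ¬Any⇒All¬ _ (λ i∈js → i∉is (js⊆is i∈js)) ∷ unique ,
    λ { (here refl) → here refl ; (there j∈) → there (js⊆is j∈) }

  DistinctWithin-skip : ∀ {i is js} → DistinctWithin is js → DistinctWithin (i ∷ is) js
  DistinctWithin-skip (unique , js⊆is) = unique , there ∘ js⊆is

  ClassesWithin : List (Fin m) → Classes → Set
  ClassesWithin is C = DistinctWithin is (pairs C) × DistinctWithin is (larges C) × DistinctWithin is (singles C)

  classify-within : ∀ {is} → Unique is → ClassesWithin is (classify is)
  classify-within {[]}     _               = ([] , λ ()) , ([] , λ ()) , ([] , λ ())
  classify-within {i ∷ is} unique@(_ ∷ unique') =
    insert-within (shape i) (classify is) (classify-within unique')
    where
    i∉ : i ∉ is
    i∉ = Unique[x∷xs]⇒x∉xs unique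
    insert-within : ∀ (s : Shape i) C → ClassesWithin is C → ClassesWithin (i ∷ is) (insert i s C)
    insert-within (single _) _ (dP , dL , dS) =
      DistinctWithin-skip dP , DistinctWithin-skip dL , DistinctWithin-cons i∉ dS
    insert-within (pair _) _ (dP , dL , dS) =
      DistinctWithin-cons i∉ dP , DistinctWithin-skip dL , DistinctWithin-skip dS
    insert-within (large _) _ (dP , dL , dS) =
      DistinctWithin-skip dP , DistinctWithin-cons i∉ dL , DistinctWithin-skip dS

  -- Covering the branch set of the first end is what makes two pieces adjacent: the edge
  -- joining their first branch sets runs between their ends.
  record Piece : Set where
    field
      end      : Bool → Fin n
      side     : Bool → Fin m
      end∈side : ∀ b → end b ∈ᵇ side b
      edge     : Adj G (end false) (end true)
      covers   : ∀ w → w ∈ᵇ side false → ∃[ b ] (w ≡ end b)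
  open Piece

  end-injective : ∀ p {b b'} → end p b ≡ end p b' → b ≡ b'
  end-injective p {false} {false} _  = refl
  end-injective p {false} {true}  eq = ⊥-elim (adj⇒≢ G (edge p) eq)
  end-injective p {true}  {false} eq = ⊥-elim (adj⇒≢ G (edge p) (sym eq))
  end-injective p {true}  {true}  _  = refl

  pairPiece : ∀ {i} → Pair i → Piece
  pairPiece {i} (u , v , u∈ , v∈ , uv , cover) = record
    { end      = λ { false → u ; true → v }
    ; side     = λ _ → i
    ; end∈side = λ { false → u∈ ; true → v∈ }
    ; edge     = uv
    ; covers   = λ w w∈ → [ (λ w≡u → false , w≡u) , (λ w≡v → true , w≡v) ]′ (cover w w∈)
    }

  singlePiece : ∀ {i j} → Single i → ∃[ u ] ∃[ v ] (u ∈ᵇ i × v ∈ᵇ j × Adj G u v) → Piece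
  singlePiece {i} {j} (_ , _ , only) (u , v , u∈ , v∈ , uv) = record
    { end      = λ { false → u ; true → v }
    ; side     = λ { false → i ; true → j }
    ; end∈side = λ { false → u∈ ; true → v∈ }
    ; edge     = uv
    ; covers   = λ w w∈ → false , trans (only w w∈) (sym (only u u∈))
    }

  record Matching (r : ℕ) (U : Fin m → Set) : Set where
    field
      piece  : Fin r → Piece
      within : ∀ k b → U (side (piece k) b)
      apart  : ∀ {k l} → k ≢ l → ∀ b b' → side (piece k) b ≢ side (piece l) b'
  open Matching

  noPieces : ∀ {U} → Matching 0 U
  noPieces = record { piece = λ () ; within = λ () ; apart = λ { {()} } }

  addPiece : ∀ {r U V} (p : Piece) → (∀ b → ¬ U (side p b)) → (∀ b → V (side p b)) →
    (∀ {i} → U i → V i) → Matching r U → Matching (suc r) V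
  addPiece {U = U} {V} p fresh inV U⊆V M = record { piece = piece' ; within = within' ; apart = apart' }
    where
    piece' : Fin (suc _) → Piece
    piece' zero    = p
    piece' (suc k) = piece M k
    within' : ∀ k b → V (side (piece' k) b)
    within' zero    b = inV b
    within' (suc k) b = U⊆V (within M k b)
    apart' : ∀ {k l} → k ≢ l → ∀ b b' → side (piece' k) b ≢ side (piece' l) b'
    apart' {zero}  {zero}  0≢0 _ _  _  = 0≢0 refl
    apart' {zero}  {suc l} _   b b' eq = fresh b (subst U (sym eq) (within M l b'))
    apart' {suc k} {zero}  _   b b' eq = fresh b' (subst U eq (within M k b))
    apart' {suc k} {suc l} k≢l b b' eq = apart M (k≢l ∘ cong suc) b b' eq

  Matching⇒HasConnectedMatching : ∀ {r U} → Matching r U → HasConnectedMatching G r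
  Matching⇒HasConnectedMatching M = e , e-injective , (λ k → edge (piece M k)) , linked
    where
    e : Fin _ × Bool → Fin n
    e (k , b) = end (piece M k) b
    e-injective : Injective _≡_ _≡_ e
    e-injective {k , b} {l , b'} eq with k Fin.≟ l
    ... | yes refl = cong (k ,_) (end-injective (piece M k) eq)
    ... | no  k≢l  = ⊥-elim (apart M k≢l b b' (∈ᵇ-unique (end∈side (piece M k) b)
                       (subst (_∈ᵇ side (piece M l) b') (sym eq) (end∈side (piece M l) b'))))
    linked : ∀ k l → k ≢ l → ∃[ b ] ∃[ b' ] Adj G (e (k , b)) (e (l , b'))
    linked k l k≢l with joined (side (piece M k) false) (side (piece M l) false) (apart M k≢l false false)
    ... | w , w' , w∈ , w'∈ , ww' with covers (piece M k) w w∈ | covers (piece M l) w' w'∈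
    ... | b , refl | b' , refl = b , b' , ww'

  Remaining : List (Fin m) → List (Fin m) → List (Fin m) → Fin m → Set
  Remaining ps ls ss i = i ∈ ps ⊎ i ∈ ls ⊎ i ∈ ss

  -- Pairs first, then each large branch set with a single, then singles two at a time;
  -- every piece uses up 2 of the budget.
  build : ∀ r {ps ls ss} → All Pair ps → All Large ls → All Single ss →
    Unique ps → Unique ls → Unique ss → length ls ≤ length ss →
    r + r ≤ (length ps + length ps) + (length ls + length ss) → Matching r (Remaining ps ls ss)
  build zero _ _ _ _ _ _ _ _ = noPieces
  build (suc r) {i ∷ ps} {ls} {ss} (p ∷ aP) aL aS uP@(_ ∷ uP') uL uS ls≤ss budget =
    addPiece (pairPiece p)
      (λ _ → [ Unique[x∷xs]⇒x∉xs uP , [ ∉-All (Pair⇒¬Large p) aL , ∉-All (flip Single⇒¬Pair p) aS ] ])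
      (λ _ → inj₁ (here refl)) (map₁ there)
      (build r aP aL aS uP' uL uS ls≤ss
        (halve-≤ (subst (suc r + suc r ≤_)
          (cong (_+ (length ls + length ss)) (double-suc (length ps))) budget)))
  build (suc r) {[]} {[]} {[]} _ _ _ _ _ _ _ ()
  build (suc r) {[]} {[]} {_ ∷ []} _ _ _ _ _ _ _ budget with subst (_≤ 1) (double-suc r) budget
  ... | s≤s ()
  build (suc r) {[]} {_ ∷ _} {[]} _ _ _ _ _ _ () _
  build (suc r) {[]} {y ∷ ls} {x ∷ ss} [] (l ∷ aL) (s ∷ aS) []
        uL@(_ ∷ uL') uS@(_ ∷ uS') (s≤s ls≤ss) budget =
    addPiece (singlePiece s (joined x y x≢y))
      (λ { false → [ (λ ()) , [ ∉-All (Single⇒¬Large s) aL , Unique[x∷xs]⇒x∉xs uS ] ]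
         ; true  → [ (λ ()) , [ Unique[x∷xs]⇒x∉xs uL , ∉-All (flip Single⇒¬Large l) aS ] ] })
      (λ { false → inj₂ (inj₂ (here refl)) ; true → inj₂ (inj₁ (here refl)) })
      (map₂ (Data.Sum.map there there))
      (build r [] aL aS [] uL' uS' ls≤ss
        (halve-≤ (subst (suc r + suc r ≤_) (cong suc (ℕP.+-suc (length ls) (length ss))) budget)))
    where
    x≢y : x ≢ y
    x≢y refl = Single⇒¬Large s l
  build (suc r) {[]} {[]} {x ∷ x' ∷ ss} [] [] (s ∷ _ ∷ aS) []
        [] ((x≢x' ∷ x∉ss) ∷ uS@(_ ∷ uS')) _ budget =
    addPiece (singlePiece s (joined x x' x≢x'))
      (λ { false → [ (λ ()) , [ (λ ()) , All¬⇒¬Any x∉ss ] ]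
         ; true  → [ (λ ()) , [ (λ ()) , Unique[x∷xs]⇒x∉xs uS ] ] })
      (λ { false → inj₂ (inj₂ (here refl)) ; true → inj₂ (inj₂ (there (here refl))) })
      (map₂ (map₂ (there ∘ there)))
      (build r [] [] aS [] [] uS' z≤n (halve-≤ budget))

  connectedMatching : ∀ t → t + t ≤ m → n < m + m → HasConnectedMatching G t
  connectedMatching t 2t≤m n<2m =
    let (uP , _) , (uL , _) , (uS , _) = classify-within (allFin⁺ m) in
    Matching⇒HasConnectedMatching
      (build t (allPair C) (allLarge C) (allSingle C) uP uL uS (ℕP.<⇒≤ larges<singles) budget)
    where
    C : Classes
    C = classify (allFin m)
    P L S : ℕ
    P = length (pairs C)
    L = length (larges C)
    S = length (singles C)
    length-allFin : length (allFin m) ≡ m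
    length-allFin = length-tabulate id
    weight : length (support (allFin m)) + S ≡ (m + m) + L
    weight = trans (support-weight (allFin m)) (cong (λ k → (k + k) + L) length-allFin)
    larges<singles : L < S
    larges<singles = ℕP.+-cancelˡ-< (m + m) L S (subst (_< (m + m) + S) weight
      (ℕP.+-monoˡ-< S (ℕP.≤-<-trans (Unique⇒length≤ (support-unique (allFin⁺ m))) n<2m)))
    budget : t + t ≤ (P + P) + (L + S)
    budget = ℕP.≤-trans 2t≤m
      (subst (_≤ (P + P) + (L + S)) (trans (sym (classify-length (allFin m))) length-allFin)
        (ℕP.+-monoˡ-≤ (L + S) (ℕP.m≤n+m P P)))

theorem1 : HadwigerConjecture →
    ∀ (t : ℕ) → 1 ≤ t → (G : Graph (4 * t ∸ 1)) →
      IsIndependenceNumber G 2 → HasConnectedMatching G t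
theorem1 hadwiger (suc t) _ G (_ , α≤2) =
  decidable-stable (hasConnectedMatching? G (suc t)) λ noMatching →
  ¬¬-least (Colourable G) (Colourable-self G) λ (χ , colourable , χ-least) →
  ¬¬-greatest (HasCompleteMinor G) (HasCompleteMinor-zero G) (HasCompleteMinor⇒≤ G)
    λ (η , minor@(f , nonempty , connected , joined) , η-greatest) →
  let noTriple = λ triple → ℕP.<⇒≱ (ℕP.n<1+n 2) (α≤2 3 triple)
      order = 4[1+t]∸1≡a+[1+a] t
      2t≤χ = a+[1+a]≤k+k⇒a<k _ χ (subst (_≤ χ + χ) order (Colourable⇒n≤k+k G colourable noTriple))
      2t≤η = ℕP.≤-trans 2t≤χ (hadwiger _ G χ η (colourable , χ-least) (minor , η-greatest))
      n<2η = subst (_< η + η) (sym order) (a<k⇒a+[1+a]<k+k 2t≤η)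
  in noMatching (BranchSets.connectedMatching G f nonempty connected joined (suc t) 2t≤η n<2η)
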